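{- The Farey function $F:\mathbb{G}_\infty\to\mathbb{Q}\cap[0,1)$ is bijective.
   Context: For $k\in\mathbb{N}_0$ let $\mathbb{G}_k=(\mathbb{Z}/2\mathbb{Z})^k$. Define $\hat h_k,\hat r_k:\{0,\dots,2^k\}\to\mathbb{N}_0$ recursively by $\hat h_0(0)=\hat h_0(1)=1$, $\hat r_0(0)=0$, $\hat r_0(1)=1$, and for $s\in\{0,\dots,2^k\}$: $\hat h_{k+1}(2s)=\hat h_k(s)$, $\hat r_{k+1}(2s)=\hat r_k(s)$; for $s\in\{0,\dots,2^k-1\}$: $\hat h_{k+1}(2s+1)=\hat h_k(s)+\hat h_k(s+1)$, $\hat r_{k+1}(2s+1)=\hat r_k(s)+\hat r_k(s+1)$. For $\sigma\in\mathbb{G}_k$ let $F_k(\sigma)=\hat r_k(s)/\hat h_k(s)$ with $s=\sum_{i=1}^k\sigma_i2^{k-i}$. Let $\mathbb{G}_\infty=\bigoplus_{\mathbb{N}}\mathbb{Z}/2\mathbb{Z}$ (0/1-sequences $(\sigma_i)_{i\ge1}$ with finitely many nonzero entries) and $F(\sigma)=F_k(\sigma_1,\dots,\sigma_k)$ for any $k$ with $\sigma_i=0$ for $i>k$ (independent of the choice of $k$). -}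

module Defs where

open import Data.Nat using (ℕ; zero; suc; _+_; _*_; NonZero)
open import Data.Nat.DivMod using (_/_; _%_)
open import Data.Bool using (Bool; true; false)
open import Data.List using (List; []; _∷_; length; foldl)
open import Data.Integer using (+_)
open import Data.Rational using (ℚ) renaming (_/_ to _/ℚ_)
open import Relation.Binary.PropositionalEquality using (_≡_)

-- ĥ_k(s) and r̂_k(s).  Only s ∈ {0,…,2^k} is meaningful; outside that
-- range the values are arbitrary junk (ĥ := 1, r̂ := 0) and never used.
hhat : ℕ → ℕ → ℕ
hhat zero zero = 1
hhat zero (suc zero) = 1
hhat zero (suc (suc _)) = 1
hhat (suc k) s with s % 2
... | zero  = hhat k (s / 2)
... | suc _ = hhat k (s / 2) + hhat k (suc (s / 2))

rhat : ℕ → ℕ → ℕ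
rhat zero zero = 0
rhat zero (suc zero) = 1
rhat zero (suc (suc _)) = 0
rhat (suc k) s with s % 2
... | zero  = rhat k (s / 2)
... | suc _ = rhat k (s / 2) + rhat k (suc (s / 2))

hhat-nonZero : ∀ k s → NonZero (hhat k s)
hhat-nonZero zero zero = _
hhat-nonZero zero (suc zero) = _
hhat-nonZero zero (suc (suc _)) = _
hhat-nonZero (suc k) s with s % 2
... | zero  = hhat-nonZero k (s / 2)
... | suc _ = plus (hhat k (s / 2)) (hhat k (suc (s / 2))) (hhat-nonZero k (s / 2))
  where
  plus : ∀ a b → NonZero a → NonZero (a + b)
  plus (suc a) b _ = _

-- Elements of G_k as bit lists (σ_1,…,σ_k); G_∞ represented by finite bit
-- lists, two lists denoting the same element iff they agree after padding
-- with zeros (see _≈G_).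
G∞ : Set
G∞ = List Bool

bit : Bool → ℕ
bit false = 0
bit true  = 1

toIndex : List Bool → ℕ
toIndex = foldl (λ acc b → 2 * acc + bit b) 0

Fk : (k s : ℕ) → ℚ
Fk k s = _/ℚ_ (+ rhat k s) (hhat k s) {{hhat-nonZero k s}}

F : G∞ → ℚ
F σ = Fk (length σ) (toIndex σ)

-- i-th entry σ_{i+1} of the 0/1-sequence (0 beyond the list)
entry : G∞ → ℕ → Bool
entry [] _ = false
entry (b ∷ _) zero = b
entry (_ ∷ σ) (suc i) = entry σ i

_≈G_ : G∞ → G∞ → Set
σ ≈G τ = ∀ i → entry σ i ≡ entry τ i

{-# OPTIONS --safe #-}
-- Write a fraction in [0,1) as a / (a + e).  Prepending a bit to σ applies one of the
-- unimodular maps (a , e) ↦ (a , a + e) or (a , e) ↦ (a + e , e), i.e. x ↦ x / (1 + x) or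
-- x ↦ 1 / (2 − x), which send [0,1) bijectively onto [0,1/2) and [1/2,1).  So F(σ) is the
-- node of a Stern–Brocot-like tree reached by reading σ from the front: injectivity follows
-- by peeling off leading bits (the empty word acts as a leading 0, which is why trailing
-- zeros do not matter), surjectivity by running the subtractive Euclidean algorithm.
-- The recursion for r̂, ĥ reads σ from the back instead: appending a bit replaces the
-- interval between the values at s and s + 1 by its left or right half, split at the
-- mediant, and carrying this interval along identifies r̂_k(s) / ĥ_k(s) with the node.
module Submission where

open import Data.Bool using (Bool; true; false)
open import Data.Empty using (⊥-elim)
import Data.Integer as ℤ
import Data.Integer.Properties as ℤ
open import Data.List using (List; []; _∷_; _∷ʳ_; length; drop)
open import Data.List.Properties using (foldl-∷ʳ; length-++)
open import Data.List.Reverse using (Reverse; reverseView; []; _∶_∶ʳ_)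
open import Data.Nat as ℕ using (ℕ; zero; suc; z<s; s≤s; _+_; _*_; _∸_; pred; compare; less; equal; greater)
open import Data.Nat.DivMod using (_/_; _%_; m*n%n≡0; m*n/n≡m; [m+kn]%n≡m%n; +-distrib-/-∣ʳ)
open import Data.Nat.Divisibility using (divides-refl)
open import Data.Nat.Induction using (<-wellFounded)
open import Data.Nat.Properties
open import Algebra.Properties.CommutativeSemigroup +-commutativeSemigroup using (interchange)
open import Data.Nat.Tactic.RingSolver using (solve-∀)
open import Data.Product using (_×_; ∃; ∃₂; _,_; proj₁; proj₂)
import Data.Product as Product
open import Data.Rational using (ℚ; mkℚ; 0ℚ; 1ℚ; _≤_; _<_; fromℚᵘ)
import Data.Rational as ℚ
import Data.Rational.Properties as ℚ
open import Data.Rational.Unnormalised using (ℚᵘ; mkℚᵘ)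
import Data.Rational.Unnormalised as ℚᵘ
import Data.Rational.Unnormalised.Properties as ℚᵘ
open import Function.Base using (_∘_)
open import Function.Bundles using (_⇔_; mk⇔; Equivalence)
open import Function.Properties.Equivalence using () renaming (trans to ⇔-trans)
open import Induction.WellFounded using (Acc; acc)
open import Relation.Binary.PropositionalEquality
open import Relation.Nullary using (¬_)

open import Defs

-- (a , e) denotes the fraction a / (a + e).
Frac : Set
Frac = ℕ × ℕ

_⊕_ : ℕ × ℕ → ℕ × ℕ → ℕ × ℕ
(a , e) ⊕ (b , f) = a + b , e + f

numDen : Frac → ℕ × ℕ
numDen (a , e) = a , a + e

numDen-⊕ : ∀ x y → numDen (x ⊕ y) ≡ numDen x ⊕ numDen y
numDen-⊕ (a , e) (b , f) = cong (a + b ,_) (interchange a b e f)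

-- x ↦ x / (1 + x) and x ↦ 1 / (2 − x), mapping [0,1) onto [0,1/2) and [1/2,1).
child : Bool → Frac → Frac
child false (a , e) = a , a + e
child true  (a , e) = a + e , e

child-⊕ : ∀ c x y → child c (x ⊕ y) ≡ child c x ⊕ child c y
child-⊕ false (a , e) (b , f) = cong (a + b ,_) (interchange a b e f)
child-⊕ true  (a , e) (b , f) = cong (_, e + f) (interchange a b e f)

interval : List Bool → Frac × Frac
interval []      = (0 , 1) , (1 , 0)
interval (c ∷ σ) = Product.map (child c) (child c) (interval σ)

node : List Bool → Frac
node σ = proj₁ (interval σ)

refine : Bool → Frac × Frac → Frac × Frac
refine false (l , r) = l , l ⊕ r
refine true  (l , r) = l ⊕ r , r

child-refine : ∀ b c I →
               Product.map (child b) (child b) (refine c I) ≡ refine c (Product.map (child b) (child b) I)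
child-refine b false (l , r) = cong (child b l ,_) (child-⊕ b l r)
child-refine b true  (l , r) = cong (_, child b r) (child-⊕ b l r)

interval-∷ʳ : ∀ σ c → interval (σ ∷ʳ c) ≡ refine c (interval σ)
interval-∷ʳ []      false = refl
interval-∷ʳ []      true  = refl
interval-∷ʳ (b ∷ σ) c     = begin
  Product.map (child b) (child b) (interval (σ ∷ʳ c))
    ≡⟨ cong (Product.map (child b) (child b)) (interval-∷ʳ σ c) ⟩
  Product.map (child b) (child b) (refine c (interval σ))
    ≡⟨ child-refine b c (interval σ) ⟩
  refine c (interval (b ∷ σ))
    ∎
  where open ≡-Reasoning

farey : ℕ → ℕ → ℕ × ℕ
farey k s = rhat k s , hhat k s

farey-suc-even : ∀ k n → n % 2 ≡ 0 → farey (suc k) n ≡ farey k (n / 2)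
farey-suc-even k n n-even with n % 2 | n-even
... | zero | _ = refl

farey-suc-odd : ∀ k n → n % 2 ≡ 1 → farey (suc k) n ≡ farey k (n / 2) ⊕ farey k (suc (n / 2))
farey-suc-odd k n n-odd with n % 2 | n-odd
... | suc _ | _ = refl

farey-even : ∀ k s → farey (suc k) (s * 2) ≡ farey k s
farey-even k s = trans (farey-suc-even k (s * 2) (m*n%n≡0 s 2)) (cong (farey k) (m*n/n≡m s 2))

farey-odd : ∀ k s → farey (suc k) (1 + s * 2) ≡ farey k s ⊕ farey k (suc s)
farey-odd k s = trans (farey-suc-odd k (1 + s * 2) ([m+kn]%n≡m%n 1 s 2))
  (cong (λ t → farey k t ⊕ farey k (suc t)) odd/2)
  where
  odd/2 : (1 + s * 2) / 2 ≡ s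
  odd/2 = trans (+-distrib-/-∣ʳ 1 {s * 2} {2} (divides-refl s)) (m*n/n≡m s 2)

farey-mediant : ∀ k s {l r} → farey k s ≡ numDen l → farey k (suc s) ≡ numDen r →
                farey (suc k) (1 + s * 2) ≡ numDen (l ⊕ r)
farey-mediant k s {l} {r} l≡ r≡ = trans (farey-odd k s) (trans (cong₂ _⊕_ l≡ r≡) (sym (numDen-⊕ l r)))

Represents : ℕ → ℕ → Frac × Frac → Set
Represents k s (l , r) = farey k s ≡ numDen l × farey k (suc s) ≡ numDen r

refine-represents : ∀ k s c I → Represents k s I → Represents (suc k) (bit c + s * 2) (refine c I)
refine-represents k s false (l , r) (l≡ , r≡) = trans (farey-even k s) l≡ , farey-mediant k s l≡ r≡
refine-represents k s true  (l , r) (l≡ , r≡) = farey-mediant k s l≡ r≡ , trans (farey-even k (suc s)) r≡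

length-∷ʳ : ∀ (σ : List Bool) c → length (σ ∷ʳ c) ≡ suc (length σ)
length-∷ʳ σ c = trans (length-++ σ) (+-comm (length σ) 1)

toIndex-∷ʳ : ∀ σ c → toIndex (σ ∷ʳ c) ≡ bit c + toIndex σ * 2
toIndex-∷ʳ σ c = trans (foldl-∷ʳ _ 0 c σ)
  (trans (+-comm (2 * toIndex σ) (bit c)) (cong (bit c +_) (*-comm 2 (toIndex σ))))

interval-represents : ∀ {σ} → Reverse σ → Represents (length σ) (toIndex σ) (interval σ)
interval-represents [] = refl , refl
interval-represents (σ ∶ r ∶ʳ c) rewrite length-∷ʳ σ c | toIndex-∷ʳ σ c | interval-∷ʳ σ c =
  refine-represents (length σ) (toIndex σ) c (interval σ) (interval-represents r)

farey≡numDen∘node : ∀ σ → farey (length σ) (toIndex σ) ≡ numDen (node σ)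
farey≡numDen∘node σ = proj₁ (interval-represents (reverseView σ))

infix 4 _≈_
_≈_ : Frac → Frac → Set
(a , e) ≈ (b , f) = a * f ≡ b * e

+-cancel-⇔ : ∀ k {m n m′ n′} → m′ ≡ k + m → n′ ≡ k + n → (m′ ≡ n′) ⇔ (m ≡ n)
+-cancel-⇔ k m′≡ n′≡ = mk⇔
  (λ eq → +-cancelˡ-≡ k _ _ (trans (sym m′≡) (trans eq n′≡)))
  (λ eq → trans m′≡ (trans (cong (k +_) eq) (sym n′≡)))

-- Both children are unimodular, so they shift a f and b e by the same amount.
child-≈⇔ : ∀ c x y → child c x ≈ child c y ⇔ x ≈ y
child-≈⇔ false (a , e) (b , f) = +-cancel-⇔ (a * b) (left a b f) (right a b e)
  where
  left : ∀ a b f → a * (b + f) ≡ a * b + a * f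
  left = solve-∀
  right : ∀ a b e → b * (a + e) ≡ a * b + b * e
  right = solve-∀
child-≈⇔ true  (a , e) (b , f) = +-cancel-⇔ (e * f) (left a e f) (right b e f)
  where
  left : ∀ a e f → (a + e) * f ≡ e * f + a * f
  left = solve-∀
  right : ∀ b e f → (b + f) * e ≡ e * f + b * e
  right = solve-∀

child-false≉child-true : ∀ x y → 0 ℕ.< proj₂ x → 0 ℕ.< proj₂ y → ¬ child false x ≈ child true y
child-false≉child-true (a , suc e) (b , suc f) _ _ eq =
  m+1+n≢m (a * suc f) (sym (trans eq (expand a b e f)))
  where
  expand : ∀ a b e f → (b + suc f) * (a + suc e) ≡ a * suc f + (suc f * suc e + b * (a + suc e))
  expand = solve-∀

child-injective : ∀ b c {x y} → 0 ℕ.< proj₂ x → 0 ℕ.< proj₂ y →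
                  child b x ≈ child c y → b ≡ c × x ≈ y
child-injective false false {x} {y} _ _ eq = refl , Equivalence.to (child-≈⇔ false x y) eq
child-injective true  true  {x} {y} _ _ eq = refl , Equivalence.to (child-≈⇔ true x y) eq
child-injective false true  {x} {y} x>0 y>0 eq = ⊥-elim (child-false≉child-true x y x>0 y>0 eq)
child-injective true  false {x} {y} x>0 y>0 eq = ⊥-elim (child-false≉child-true y x y>0 x>0 (sym eq))

node-positive : ∀ σ → 0 ℕ.< proj₂ (node σ)
node-positive []          = z<s
node-positive (false ∷ σ) = <-≤-trans (node-positive σ) (m≤n+m _ _)
node-positive (true  ∷ σ) = node-positive σ

-- The empty word behaves as false ∷ [], matching the padding with zeros in G∞.
node-unfold : ∀ σ → node σ ≡ child (entry σ 0) (node (drop 1 σ))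
node-unfold []      = refl
node-unfold (_ ∷ _) = refl

≈G-unfold : ∀ σ τ → entry σ 0 ≡ entry τ 0 → drop 1 σ ≈G drop 1 τ → σ ≈G τ
≈G-unfold σ τ head≡ tail≈ zero    = head≡
≈G-unfold σ τ head≡ tail≈ (suc i) = trans (entry-suc σ) (trans (tail≈ i) (sym (entry-suc τ)))
  where
  entry-suc : ∀ σ → entry σ (suc i) ≡ entry (drop 1 σ) i
  entry-suc []      = refl
  entry-suc (_ ∷ _) = refl

node-injective-step : ∀ σ τ → (node (drop 1 σ) ≈ node (drop 1 τ) → drop 1 σ ≈G drop 1 τ) →
                      node σ ≈ node τ → σ ≈G τ
node-injective-step σ τ ih eq
  with child-injective (entry σ 0) (entry τ 0) (node-positive (drop 1 σ)) (node-positive (drop 1 τ))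
         (subst₂ _≈_ (node-unfold σ) (node-unfold τ) eq)
... | head≡ , tail≈ = ≈G-unfold σ τ head≡ (ih tail≈)

node-injective : ∀ σ τ → node σ ≈ node τ → σ ≈G τ
node-injective []      []      _ _ = refl
node-injective []      (c ∷ τ) = node-injective-step [] (c ∷ τ) (node-injective [] τ)
node-injective (b ∷ σ) []      = node-injective-step (b ∷ σ) [] (node-injective σ [])
node-injective (b ∷ σ) (c ∷ τ) = node-injective-step (b ∷ σ) (c ∷ τ) (node-injective σ τ)

size : Frac → ℕ
size (a , e) = a + e

parent : ∀ a e → ∃₂ λ c x →
         0 ℕ.< proj₂ x × size x ℕ.< size (suc a , suc e) × child c x ≡ (suc a , suc e)
parent a e with compare a e
... | less .a k    = false , (suc a , suc k) , z<s , +-monoʳ-< (suc a) (s≤s (s≤s (m≤n+m k a))) ,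
                     cong (λ t → suc a , suc t) (+-suc a k)
... | equal .a     = true , (0 , suc a) , z<s , s≤s (m≤n+m (suc a) a) , refl
... | greater .e k = true , (suc k , suc e) , z<s , s≤s (s≤s (+-monoˡ-≤ (suc e) (m≤n+m k e))) ,
                     cong (λ t → suc t , suc e) (trans (+-suc k e) (cong suc (+-comm k e)))

node-surjective : ∀ x → 0 ℕ.< proj₂ x → ∃ λ σ → node σ ≈ x
node-surjective x x>0 = go x x>0 (<-wellFounded (size x))
  where
  go : ∀ x → 0 ℕ.< proj₂ x → Acc ℕ._<_ (size x) → ∃ λ σ → node σ ≈ x
  go (zero  , suc e) _ _ = [] , refl
  go (suc a , suc e) _ (acc smaller) with parent a e
  ... | c , y , y>0 , y<x , child≡x with go y y>0 (smaller y<x)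
  ...   | σ , node≈y =
    c ∷ σ , subst (node (c ∷ σ) ≈_) child≡x (Equivalence.from (child-≈⇔ c (node σ) y) node≈y)

pos-*-≡⇔ : ∀ a m b n → ℤ.+ a ℤ.* ℤ.+ m ≡ ℤ.+ b ℤ.* ℤ.+ n ⇔ a * m ≡ b * n
pos-*-≡⇔ a m b n = mk⇔
  (λ eq → ℤ.+-injective (trans (ℤ.pos-* a m) (trans eq (sym (ℤ.pos-* b n)))))
  (λ eq → trans (sym (ℤ.pos-* a m)) (trans (cong ℤ.+_ eq) (ℤ.pos-* b n)))

pos-*-<⇔ : ∀ a m b n → ℤ.+ a ℤ.* ℤ.+ m ℤ.< ℤ.+ b ℤ.* ℤ.+ n ⇔ a * m ℕ.< b * n
pos-*-<⇔ a m b n = mk⇔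
  (λ lt → ℤ.drop‿+<+ (subst₂ ℤ._<_ (sym (ℤ.pos-* a m)) (sym (ℤ.pos-* b n)) lt))
  (λ lt → subst₂ ℤ._<_ (ℤ.pos-* a m) (ℤ.pos-* b n) (ℤ.+<+ lt))

-- a / (a + e), read with a junk denominator 1 when a + e = 0.
valueᵘ : Frac → ℚᵘ
valueᵘ (a , e) = mkℚᵘ (ℤ.+ a) (pred (a + e))

value : Frac → ℚ
value x = fromℚᵘ (valueᵘ x)

/-≡-fromℚᵘ : ∀ n d .{{_ : ℕ.NonZero d}} → ℤ.+ n ℚ./ d ≡ fromℚᵘ (mkℚᵘ (ℤ.+ n) (pred d))
/-≡-fromℚᵘ n (suc d) = refl

F≡value∘node : ∀ σ → F σ ≡ value (node σ)
F≡value∘node σ = trans (/-≡-fromℚᵘ (rhat k s) (hhat k s) {{hhat-nonZero k s}})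
  (cong (λ (r , h) → fromℚᵘ (mkℚᵘ (ℤ.+ r) (pred h))) (farey≡numDen∘node σ))
  where
  k = length σ
  s = toIndex σ

suc-pred-size : ∀ x → 0 ℕ.< proj₂ x → suc (pred (size x)) ≡ size x
suc-pred-size (a , suc e) _ = trans (cong (suc ∘ pred) (+-suc a e)) (sym (+-suc a e))

valueᵘ-≃⇔≈ : ∀ x y → 0 ℕ.< proj₂ x → 0 ℕ.< proj₂ y → valueᵘ x ℚᵘ.≃ valueᵘ y ⇔ x ≈ y
valueᵘ-≃⇔≈ x@(a , _) y@(b , _) x>0 y>0 =
  ⇔-trans (mk⇔ (λ { (ℚᵘ.*≡* eq) → eq }) ℚᵘ.*≡*)
  (⇔-trans (pos-*-≡⇔ a _ b _)
  (subst₂ (λ m n → (a * m ≡ b * n) ⇔ x ≈ y)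
    (sym (suc-pred-size y y>0)) (sym (suc-pred-size x x>0)) (child-≈⇔ false x y)))

value-≡⇔≈ : ∀ x y → 0 ℕ.< proj₂ x → 0 ℕ.< proj₂ y → value x ≡ value y ⇔ x ≈ y
value-≡⇔≈ x y x>0 y>0 = ⇔-trans (mk⇔ ℚ.fromℚᵘ-injective ℚ.fromℚᵘ-cong) (valueᵘ-≃⇔≈ x y x>0 y>0)

value-nonNeg : ∀ x → 0ℚ ≤ value x
value-nonNeg (a , e) = ℚ.nonNegative⁻¹ (value (a , e)) {{ℚ.normalize-nonNeg a (suc (pred (a + e)))}}

value<1 : ∀ x → 0 ℕ.< proj₂ x → value x < 1ℚ
value<1 x@(a , e) e>0 = ℚ.toℚᵘ-cancel-<
  (ℚᵘ.<-respˡ-≃ (ℚᵘ.≃-sym (ℚ.toℚᵘ-fromℚᵘ (valueᵘ x)))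
    (ℚᵘ.*<* (Equivalence.from (pos-*-<⇔ a 1 1 _)
      (subst₂ ℕ._<_ (sym (*-identityʳ a)) (sym (trans (*-identityˡ _) (suc-pred-size x e>0)))
        (m<m+n a e>0)))))

value-surjective : ∀ q → 0ℚ ≤ q → q < 1ℚ → ∃ λ x → 0 ℕ.< proj₂ x × value x ≡ q
value-surjective (mkℚ ℤ.-[1+ _ ] _ _) (ℚ.*≤* ()) _
value-surjective q@(mkℚ (ℤ.+ n) d-1 _) _ (ℚ.*<* q<1) =
  (n , suc d-1 ∸ n) , m<n⇒0<n∸m n<d ,
  trans (cong (λ d → fromℚᵘ (mkℚᵘ (ℤ.+ n) (pred d))) (m+[n∸m]≡n (<⇒≤ n<d))) (ℚ.fromℚᵘ-toℚᵘ q)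
  where
  n<d : n ℕ.< suc d-1
  n<d = subst₂ ℕ._<_ (*-identityʳ n) (*-identityˡ (suc d-1))
          (Equivalence.to (pos-*-<⇔ n 1 1 (suc d-1)) q<1)

proposition3p2 : (∀ σ → 0ℚ ≤ F σ × F σ < 1ℚ)
    × (∀ σ τ → F σ ≡ F τ → σ ≈G τ)
    × (∀ (q : ℚ) → 0ℚ ≤ q → q < 1ℚ → ∃ λ σ → F σ ≡ q)
proposition3p2 = bounded , injective , surjective
  where
  node-value≡⇔≈ : ∀ σ x → 0 ℕ.< proj₂ x → value (node σ) ≡ value x ⇔ node σ ≈ x
  node-value≡⇔≈ σ x x>0 = value-≡⇔≈ (node σ) x (node-positive σ) x>0

  bounded : ∀ σ → 0ℚ ≤ F σ × F σ < 1ℚ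
  bounded σ rewrite F≡value∘node σ = value-nonNeg (node σ) , value<1 (node σ) (node-positive σ)

  injective : ∀ σ τ → F σ ≡ F τ → σ ≈G τ
  injective σ τ Fσ≡Fτ = node-injective σ τ
    (Equivalence.to (node-value≡⇔≈ σ (node τ) (node-positive τ))
      (trans (sym (F≡value∘node σ)) (trans Fσ≡Fτ (F≡value∘node τ))))

  surjective : ∀ (q : ℚ) → 0ℚ ≤ q → q < 1ℚ → ∃ λ σ → F σ ≡ q
  surjective q 0≤q q<1 with value-surjective q 0≤q q<1
  ... | x , x>0 , value≡q with node-surjective x x>0
  ...   | σ , node≈x =
    σ , trans (F≡value∘node σ) (trans (Equivalence.from (node-value≡⇔≈ σ x x>0) node≈x) value≡q)
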